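{- Let $(a_{ij})\in\mathbb Z^{n\times r}_{\ge0}(m)$ and $k\in\{1,\dots,n\}$. If $k$ is a maximum of $(a_{ij})$, then $k-1$ is a maximum of $\rho\cdot(a_{ij})$ and $k+1$ is a maximum of $\rho^{ -1}\cdot(a_{ij})$ (indices taken mod $n$ in $\{1,\dots,n\}$). In other words, $k$ is a maximum of $(a_{ij})$ if and only if $k-1$ is a maximum of $\rho\cdot(a_{ij})$.
   Context: $m,n,r$ are positive integers (not necessarily coprime). $\mathbb Z^{n\times r}_{\ge0}(m)$ is the set of tuples $(a_{11},\dots,a_{1r}\mid a_{21},\dots,a_{2r}\mid\dots\mid a_{n1},\dots,a_{nr})\in\mathbb Z^{nr}_{\ge0}$ with $\sum_{i,j}a_{ij}=m$. Set $a_i=\sum_{j=1}^ra_{ij}$ and $t_k(a_{ij})=\frac{mk}n-a_1-\dots-a_k$ for $k=1,\dots,n$; $k$ is a maximum of $(a_{ij})$ if it maximizes $t_k(a_{ij})$ over $k\in\{1,\dots,n\}$. The cyclic group $\mathbb Z/(n)=\langle\rho\rangle$ acts by $\rho\cdot(a_{1\bullet}\mid a_{2\bullet}\mid\dots\mid a_{n\bullet})=(a_{2\bullet}\mid\dots\mid a_{n\bullet}\mid a_{1\bullet})$, where $a_{i\bullet}=(a_{i1},\dots,a_{ir})$. -}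

module Defs where

open import Data.Nat as ℕ using (ℕ; zero; suc; _+_; _*_; _∸_; _≤_; _<ᵇ_; NonZero)
open import Data.Nat.DivMod using (_mod_)
open import Data.Fin using (Fin; toℕ) renaming (zero to fzero; suc to fsuc)
open import Data.Bool using (if_then_else_)
open import Data.Integer using (+_)
open import Data.Rational as ℚ using (ℚ)
open import Relation.Binary.PropositionalEquality using (_≡_)

sumFin : ∀ {k} → (Fin k → ℕ) → ℕ
sumFin {zero} f = 0
sumFin {suc k} f = f fzero + sumFin (λ i → f (fsuc i))

-- A tuple (a_{ij}) with 1 ≤ i ≤ n, 1 ≤ j ≤ r; row i (0-based Fin index) is
-- the paper's row i+1.
Tuple : ℕ → ℕ → Set
Tuple n r = Fin n → Fin r → ℕ

rowSum : ∀ {n r} → Tuple n r → Fin n → ℕ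
rowSum a i = sumFin (a i)

total : ∀ {n r} → Tuple n r → ℕ
total a = sumFin (rowSum a)

InZ : ∀ {n r} → ℕ → Tuple n r → Set
InZ m a = total a ≡ m

-- a_1 + … + a_k  (paper indices), for k ∈ ℕ
partialSum : ∀ {n r} → Tuple n r → ℕ → ℕ
partialSum a k = sumFin (λ i → if toℕ i <ᵇ k then rowSum a i else 0)

t : ∀ {n r} (m : ℕ) .{{_ : NonZero n}} → Tuple n r → ℕ → ℚ
t {n} m a k = ((+ (m * k)) ℚ./ n) ℚ.- ((+ partialSum a k) ℚ./ 1)

IsMax : ∀ {n r} (m : ℕ) .{{_ : NonZero n}} → Tuple n r → ℕ → Set
IsMax {n} m a k = (1 ≤ k) × (k ≤ n) × (∀ j → 1 ≤ j → j ≤ n → t m a j ℚ.≤ t m a k)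
  where open import Data.Product using (_×_)

shiftUp : ∀ {n} .{{_ : NonZero n}} → Fin n → Fin n
shiftUp {n} i = (suc (toℕ i)) mod n

shiftDown : ∀ {n} .{{_ : NonZero n}} → Fin n → Fin n
shiftDown {n} i = (toℕ i + (n ∸ 1)) mod n

-- ρ · (a_{1•} | a_{2•} | … | a_{n•}) = (a_{2•} | … | a_{n•} | a_{1•})
ρ· : ∀ {n r} .{{_ : NonZero n}} → Tuple n r → Tuple n r
ρ· a i = a (shiftUp i)

-- ρ⁻¹ · (a_{1•} | … | a_{n•}) = (a_{n•} | a_{1•} | … | a_{(n-1)•})
ρ⁻¹· : ∀ {n r} .{{_ : NonZero n}} → Tuple n r → Tuple n r
ρ⁻¹· a i = a (shiftDown i)

predMod : ℕ → ℕ → ℕ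
predMod n 1 = n
predMod n k = k ∸ 1

succMod : ℕ → ℕ → ℕ
succMod n k = if k ℕ.≡ᵇ n then 1 else suc k

-- Only the row sums a_i enter t_k.  Rotating the rows by ρ turns the prefix sums
-- a_2 + … + a_k of ρ·a into (a_1 + … + a_k) − a_1, so t_{k−1}(ρ·a) = t_k(a) + (a_1 − m/n)
-- for 2 ≤ k ≤ n; since t_0 = t_n = 0 when the total is m, the case k = 1 fits the same
-- formula with k − 1 read as n.  Thus k ↦ k − 1 (mod n) is a bijection of {1, …, n}
-- carrying t(a) to t(ρ·a) up to an additive constant, and such a reindexing preserves
-- maxima.  The statement for ρ⁻¹ is the same fact applied to ρ⁻¹·a, since ρ·(ρ⁻¹·a) = a.
module Submission where

open import Defs
open import Algebra.Properties.CommutativeSemigroup using (xy∙z≈xz∙y)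
open import Data.Bool using (T; if_then_else_; true; false)
open import Data.Empty using (⊥-elim)
open import Data.Fin using (Fin; toℕ; fromℕ<) renaming (zero to fzero; suc to fsuc)
import Data.Fin.Properties as FinP
open import Data.Integer as ℤ using () renaming (+_ to ⁺_)
import Data.Integer.Properties as ℤP
open import Data.Nat as ℕ using (ℕ; NonZero; zero; suc; _+_; _*_; _≤_; _<_; z≤n; s≤s)
open import Data.Nat.DivMod using (_%_; m<n⇒m%n≡m; n%n≡0; %-distribˡ-+; [m+n]%n≡m%n)
import Data.Nat.Properties as ℕP
open import Data.Product using (_×_; _,_)
open import Data.Rational as ℚ using (ℚ; 0ℚ; _/_; toℚᵘ)
import Data.Rational.Properties as ℚP
open import Data.Rational.Solver using (module +-*-Solver)
open import Data.Rational.Unnormalised using (mkℚᵘ; *≡*) renaming (_+_ to _+ᵘ_)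
import Data.Rational.Unnormalised.Properties as ℚᵘP
open import Data.Sum using (inj₁; inj₂)
open import Function using (_∘_)
open import Function.Bundles using (_⇔_; mk⇔; module Equivalence)
open import Relation.Binary.PropositionalEquality
open import Relation.Nullary using (contradiction)

+-distrib-/ : ∀ i j n .{{_ : NonZero n}} → (i ℤ.+ j) / n ≡ i / n ℚ.+ j / n
+-distrib-/ i j (suc d) = ℚP.toℚᵘ-injective (begin
    toℚᵘ ((i ℤ.+ j) / suc d)              ≈⟨ ℚP.toℚᵘ-fromℚᵘ (mkℚᵘ (i ℤ.+ j) d) ⟩
    mkℚᵘ (i ℤ.+ j) d                      ≈⟨ *≡* cross ⟩
    mkℚᵘ i d +ᵘ mkℚᵘ j d                  ≈⟨ ℚᵘP.+-cong (ℚP.toℚᵘ-fromℚᵘ (mkℚᵘ i d)) (ℚP.toℚᵘ-fromℚᵘ (mkℚᵘ j d)) ⟨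
    toℚᵘ (i / suc d) +ᵘ toℚᵘ (j / suc d) ≈⟨ ℚP.toℚᵘ-homo-+ (i / suc d) (j / suc d) ⟨
    toℚᵘ (i / suc d ℚ.+ j / suc d)        ∎)
  where
  open ℚᵘP.≃-Reasoning
  n = ⁺ suc d
  cross : (i ℤ.+ j) ℤ.* (n ℤ.* n) ≡ (i ℤ.* n ℤ.+ j ℤ.* n) ℤ.* n
  cross = trans (sym (ℤP.*-assoc (i ℤ.+ j) n n)) (cong (ℤ._* n) (ℤP.*-distribʳ-+ n i j))

*-cancelʳ-/ : ∀ m n .{{_ : NonZero n}} → (⁺ (m * n)) / n ≡ (⁺ m) / 1
*-cancelʳ-/ m (suc d) = ℚP.fromℚᵘ-cong {mkℚᵘ (⁺ (m * suc d)) d} {mkℚᵘ (⁺ m) 0}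
  (*≡* (trans (ℤP.*-identityʳ _) (ℤP.pos-* m (suc d))))

+-cancelʳ-≤ : ∀ c {p q} → p ℚ.+ c ℚ.≤ q ℚ.+ c → p ℚ.≤ q
+-cancelʳ-≤ c {p} {q} p+c≤q+c =
  subst₂ ℚ._≤_ (add-sub p c) (add-sub q c) (ℚP.+-monoˡ-≤ (ℚ.- c) p+c≤q+c)
  where
  open +-*-Solver
  add-sub : ∀ x c → (x ℚ.+ c) ℚ.- c ≡ x
  add-sub = solve 2 (λ x c → (x :+ c) :- c := x) refl

prefixSum : ∀ {n} → (Fin n → ℕ) → ℕ → ℕ
prefixSum f k = sumFin (λ i → if toℕ i ℕ.<ᵇ k then f i else 0)

sumFin-zero : ∀ n → sumFin {n} (λ _ → 0) ≡ 0
sumFin-zero zero = refl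
sumFin-zero (suc n) = sumFin-zero n

prefixSum-zero : ∀ {n} (f : Fin n → ℕ) → prefixSum f 0 ≡ 0
prefixSum-zero {n} f = sumFin-zero n

prefixSum-suc : ∀ {n} (f : Fin n → ℕ) k (k<n : k < n) →
                prefixSum f (suc k) ≡ prefixSum f k + f (fromℕ< k<n)
prefixSum-suc {suc n} f zero k<n = begin
    f fzero + prefixSum (f ∘ fsuc) 0 ≡⟨ cong (f fzero +_) (prefixSum-zero (f ∘ fsuc)) ⟩
    f fzero + 0                      ≡⟨ ℕP.+-comm (f fzero) 0 ⟩
    0 + f fzero                      ≡⟨ cong (_+ f fzero) (prefixSum-zero f) ⟨
    prefixSum f 0 + f fzero          ∎
  where open ≡-Reasoning
prefixSum-suc {suc n} f (suc k) (s≤s k<n) =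
  trans (cong (f fzero +_) (prefixSum-suc (f ∘ fsuc) k k<n)) (sym (ℕP.+-assoc (f fzero) _ _))

prefixSum-full : ∀ {n} (f : Fin n → ℕ) → prefixSum f n ≡ sumFin f
prefixSum-full {zero} f = refl
prefixSum-full {suc n} f = cong (f fzero +_) (prefixSum-full (f ∘ fsuc))

-- Definitionally, t m a = tRows m (rowSum a) and IsMax m a = IsArgmax n (t m a).
tRows : ∀ (m : ℕ) {n} .{{_ : NonZero n}} → (Fin n → ℕ) → ℕ → ℚ
tRows m {n} f k = (⁺ (m * k)) / n ℚ.- (⁺ prefixSum f k) / 1

tRows-zero : ∀ m {n} .{{_ : NonZero n}} (f : Fin n → ℕ) → tRows m f 0 ≡ 0ℚ
tRows-zero m {n} f = begin
    (⁺ (m * 0)) / n ℚ.- (⁺ prefixSum f 0) / 1 ≡⟨ cong₂ (λ x y → (⁺ x) / n ℚ.- (⁺ y) / 1) (ℕP.*-zeroʳ m) (prefixSum-zero f) ⟩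
    (⁺ 0) / n ℚ.- (⁺ 0) / 1                   ≡⟨ cong (ℚ._- (⁺ 0) / 1) (*-cancelʳ-/ 0 n) ⟩
    (⁺ 0) / 1 ℚ.- (⁺ 0) / 1                   ≡⟨ ℚP.+-inverseʳ ((⁺ 0) / 1) ⟩
    0ℚ                                        ∎
  where open ≡-Reasoning

tRows-full : ∀ m {n} .{{_ : NonZero n}} (f : Fin n → ℕ) → sumFin f ≡ m → tRows m f n ≡ 0ℚ
tRows-full m {n} f Σf≡m = begin
    (⁺ (m * n)) / n ℚ.- (⁺ prefixSum f n) / 1 ≡⟨ cong₂ (λ x y → x ℚ.- (⁺ y) / 1) (*-cancelʳ-/ m n) (trans (prefixSum-full f) Σf≡m) ⟩
    (⁺ m) / 1 ℚ.- (⁺ m) / 1                   ≡⟨ ℚP.+-inverseʳ ((⁺ m) / 1) ⟩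
    0ℚ                                        ∎
  where open ≡-Reasoning

IsArgmax : ℕ → (ℕ → ℚ) → ℕ → Set
IsArgmax n T k = (1 ≤ k) × (k ≤ n) × (∀ j → 1 ≤ j → j ≤ n → T j ℚ.≤ T k)

module _ {n : ℕ} {T T′ : ℕ → ℚ} (σ τ : ℕ → ℕ) (c : ℚ)
         (σ-range : ∀ {k} → 1 ≤ k → k ≤ n → (1 ≤ σ k) × (σ k ≤ n))
         (τ-range : ∀ {j} → 1 ≤ j → j ≤ n → (1 ≤ τ j) × (τ j ≤ n))
         (σ∘τ≡id : ∀ {j} → 1 ≤ j → j ≤ n → σ (τ j) ≡ j)
         (T′∘σ≡T+c : ∀ {k} → 1 ≤ k → k ≤ n → T′ (σ k) ≡ T k ℚ.+ c) where

  IsArgmax-reindex : ∀ {k} → 1 ≤ k → k ≤ n → IsArgmax n T k ⇔ IsArgmax n T′ (σ k)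
  IsArgmax-reindex {k} 1≤k k≤n = mk⇔ to from
    where
    to : IsArgmax n T k → IsArgmax n T′ (σ k)
    to (_ , _ , T≤T[k]) with σ-range 1≤k k≤n
    ... | 1≤σk , σk≤n = 1≤σk , σk≤n , λ j 1≤j j≤n → let 1≤τj , τj≤n = τ-range 1≤j j≤n in begin
      T′ j           ≡⟨ cong T′ (σ∘τ≡id 1≤j j≤n) ⟨
      T′ (σ (τ j))   ≡⟨ T′∘σ≡T+c 1≤τj τj≤n ⟩
      T (τ j) ℚ.+ c  ≤⟨ ℚP.+-monoˡ-≤ c (T≤T[k] (τ j) 1≤τj τj≤n) ⟩
      T k ℚ.+ c      ≡⟨ T′∘σ≡T+c 1≤k k≤n ⟨
      T′ (σ k)       ∎
      where open ℚP.≤-Reasoning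
    from : IsArgmax n T′ (σ k) → IsArgmax n T k
    from (_ , _ , T′≤T′[σk]) = 1≤k , k≤n , λ j 1≤j j≤n → let 1≤σj , σj≤n = σ-range 1≤j j≤n in
      +-cancelʳ-≤ c (begin
        T j ℚ.+ c  ≡⟨ T′∘σ≡T+c 1≤j j≤n ⟨
        T′ (σ j)   ≤⟨ T′≤T′[σk] (σ j) 1≤σj σj≤n ⟩
        T′ (σ k)   ≡⟨ T′∘σ≡T+c 1≤k k≤n ⟩
        T k ℚ.+ c  ∎)
      where open ℚP.≤-Reasoning

succMod-< : ∀ n j → j < n → succMod n j ≡ suc j
succMod-< n j j<n with j ℕ.≡ᵇ n in j≡ᵇn
... | false = refl
... | true = contradiction (ℕP.≡ᵇ⇒≡ j n (subst T (sym j≡ᵇn) _)) (ℕP.<⇒≢ j<n)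

succMod-self : ∀ n → succMod n n ≡ 1
succMod-self n with n ℕ.≡ᵇ n in n≡ᵇn
... | true = refl
... | false = ⊥-elim (subst T n≡ᵇn (ℕP.≡⇒≡ᵇ n n refl))

predMod-range : ∀ n {k} → 1 ≤ k → k ≤ n → (1 ≤ predMod n k) × (predMod n k ≤ n)
predMod-range n {suc zero} _ k≤n = k≤n , ℕP.≤-refl
predMod-range n {suc (suc k)} _ k≤n = s≤s z≤n , ℕP.≤-trans (ℕP.n≤1+n _) k≤n

succMod-range : ∀ n {j} → 1 ≤ j → j ≤ n → (1 ≤ succMod n j) × (succMod n j ≤ n)
succMod-range n {j} 1≤j j≤n with ℕP.m≤n⇒m<n∨m≡n j≤n
... | inj₁ j<n rewrite succMod-< n j j<n = s≤s z≤n , j<n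
... | inj₂ refl rewrite succMod-self j = ℕP.≤-refl , 1≤j

predMod-succMod : ∀ n {j} → 1 ≤ j → j ≤ n → predMod n (succMod n j) ≡ j
predMod-succMod n {suc j} _ j≤n with ℕP.m≤n⇒m<n∨m≡n j≤n
... | inj₁ j<n rewrite succMod-< n (suc j) j<n = refl
... | inj₂ refl rewrite succMod-self (suc j) = refl

module _ {n : ℕ} where

  toℕ-shiftUp : ∀ (i : Fin (suc n)) → toℕ (shiftUp i) ≡ suc (toℕ i) % suc n
  toℕ-shiftUp i = FinP.toℕ-fromℕ< _

  shiftUp-fromℕ< : ∀ j (j<n : j < suc n) (j+1<n : suc j < suc n) →
                   shiftUp (fromℕ< j<n) ≡ fromℕ< j+1<n
  shiftUp-fromℕ< j j<n j+1<n = FinP.toℕ-injective (begin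
      toℕ (shiftUp (fromℕ< j<n))     ≡⟨ toℕ-shiftUp (fromℕ< j<n) ⟩
      suc (toℕ (fromℕ< j<n)) % suc n ≡⟨ cong (λ x → suc x % suc n) (FinP.toℕ-fromℕ< j<n) ⟩
      suc j % suc n                  ≡⟨ m<n⇒m%n≡m j+1<n ⟩
      suc j                          ≡⟨ FinP.toℕ-fromℕ< j+1<n ⟨
      toℕ (fromℕ< j+1<n)             ∎)
    where open ≡-Reasoning

  shiftUp-last : shiftUp (fromℕ< (ℕP.n<1+n n)) ≡ fzero
  shiftUp-last = FinP.toℕ-injective (begin
      toℕ (shiftUp (fromℕ< (ℕP.n<1+n n)))     ≡⟨ toℕ-shiftUp (fromℕ< (ℕP.n<1+n n)) ⟩
      suc (toℕ (fromℕ< (ℕP.n<1+n n))) % suc n ≡⟨ cong (λ x → suc x % suc n) (FinP.toℕ-fromℕ< (ℕP.n<1+n n)) ⟩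
      suc n % suc n                           ≡⟨ n%n≡0 (suc n) ⟩
      0                                       ∎)
    where open ≡-Reasoning

  shiftDown-shiftUp : ∀ (i : Fin (suc n)) → shiftDown (shiftUp i) ≡ i
  shiftDown-shiftUp i = FinP.toℕ-injective (begin
      toℕ (shiftDown (shiftUp i))               ≡⟨ FinP.toℕ-fromℕ< _ ⟩
      (toℕ (shiftUp i) + n) % suc n             ≡⟨ cong (λ x → (x + n) % suc n) (toℕ-shiftUp i) ⟩
      (suc (toℕ i) % suc n + n) % suc n         ≡⟨ cong (λ x → (suc (toℕ i) % suc n + x) % suc n) (m<n⇒m%n≡m (ℕP.n<1+n n)) ⟨
      (suc (toℕ i) % suc n + n % suc n) % suc n ≡⟨ %-distribˡ-+ (suc (toℕ i)) n (suc n) ⟨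
      (suc (toℕ i) + n) % suc n                 ≡⟨ cong (_% suc n) (ℕP.+-comm (suc (toℕ i)) n) ⟩
      (n + suc (toℕ i)) % suc n                 ≡⟨ cong (_% suc n) (ℕP.+-suc n (toℕ i)) ⟩
      (suc n + toℕ i) % suc n                   ≡⟨ cong (_% suc n) (ℕP.+-comm (suc n) (toℕ i)) ⟩
      (toℕ i + suc n) % suc n                   ≡⟨ [m+n]%n≡m%n (toℕ i) (suc n) ⟩
      toℕ i % suc n                             ≡⟨ m<n⇒m%n≡m (FinP.toℕ<n i) ⟩
      toℕ i                                     ∎)
    where open ≡-Reasoning

module Rotation {n : ℕ} (f g : Fin (suc n) → ℕ) (g≗f∘shiftUp : g ≗ f ∘ shiftUp) where

  prefixSum-rotate : ∀ j → j < suc n → prefixSum g j + f fzero ≡ prefixSum f (suc j)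
  prefixSum-rotate zero 0<n = begin
      prefixSum g 0 + f fzero ≡⟨ cong (_+ f fzero) (trans (prefixSum-zero g) (sym (prefixSum-zero f))) ⟩
      prefixSum f 0 + f fzero ≡⟨ prefixSum-suc f 0 0<n ⟨
      prefixSum f 1           ∎
    where open ≡-Reasoning
  prefixSum-rotate (suc j) j+1<n = begin
      prefixSum g (suc j) + f fzero            ≡⟨ cong (_+ f fzero) (prefixSum-suc g j j<n) ⟩
      prefixSum g j + g (fromℕ< j<n) + f fzero ≡⟨ xy∙z≈xz∙y ℕP.+-commutativeSemigroup (prefixSum g j) _ _ ⟩
      prefixSum g j + f fzero + g (fromℕ< j<n) ≡⟨ cong₂ _+_ (prefixSum-rotate j j<n) g[j]≡f[j+1] ⟩
      prefixSum f (suc j) + f (fromℕ< j+1<n)   ≡⟨ prefixSum-suc f (suc j) j+1<n ⟨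
      prefixSum f (suc (suc j))                ∎
    where
    open ≡-Reasoning
    j<n = ℕP.<-trans (ℕP.n<1+n j) j+1<n
    g[j]≡f[j+1] : g (fromℕ< j<n) ≡ f (fromℕ< j+1<n)
    g[j]≡f[j+1] = trans (g≗f∘shiftUp _) (cong f (shiftUp-fromℕ< j j<n j+1<n))

  sumFin-rotate : sumFin g ≡ sumFin f
  sumFin-rotate = begin
      sumFin g                                   ≡⟨ prefixSum-full g ⟨
      prefixSum g (suc n)                        ≡⟨ prefixSum-suc g n (ℕP.n<1+n n) ⟩
      prefixSum g n + g (fromℕ< (ℕP.n<1+n n))    ≡⟨ cong (prefixSum g n +_) (trans (g≗f∘shiftUp _) (cong f shiftUp-last)) ⟩
      prefixSum g n + f fzero                    ≡⟨ prefixSum-rotate n (ℕP.n<1+n n) ⟩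
      prefixSum f (suc n)                        ≡⟨ prefixSum-full f ⟩
      sumFin f                                   ∎
    where open ≡-Reasoning

  module _ (m : ℕ) where

    shiftConstant : ℚ
    shiftConstant = (⁺ f fzero) / 1 ℚ.- (⁺ m) / suc n

    tRows-rotate : ∀ j → j < suc n → tRows m g j ≡ tRows m f (suc j) ℚ.+ shiftConstant
    tRows-rotate j j<n = begin
        A ℚ.- B                                 ≡⟨ regroup A B M F ⟩
        ((M ℚ.+ A) ℚ.- (B ℚ.+ F)) ℚ.+ (F ℚ.- M) ≡⟨ cong₂ (λ x y → (x ℚ.- y) ℚ.+ (F ℚ.- M)) M+A≡m[j+1]/n B+F≡prefixSum[j+1] ⟩
        tRows m f (suc j) ℚ.+ shiftConstant     ∎
      where
      open ≡-Reasoning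
      A = (⁺ (m * j)) / suc n
      B = (⁺ prefixSum g j) / 1
      M = (⁺ m) / suc n
      F = (⁺ f fzero) / 1
      regroup : ∀ A B M F → A ℚ.- B ≡ ((M ℚ.+ A) ℚ.- (B ℚ.+ F)) ℚ.+ (F ℚ.- M)
      regroup = solve 4 (λ A B M F → A :- B := ((M :+ A) :- (B :+ F)) :+ (F :- M)) refl
        where open +-*-Solver
      M+A≡m[j+1]/n : M ℚ.+ A ≡ (⁺ (m * suc j)) / suc n
      M+A≡m[j+1]/n = trans (sym (+-distrib-/ (⁺ m) (⁺ (m * j)) (suc n))) (cong (λ x → (⁺ x) / suc n) (sym (ℕP.*-suc m j)))
      B+F≡prefixSum[j+1] : B ℚ.+ F ≡ (⁺ prefixSum f (suc j)) / 1
      B+F≡prefixSum[j+1] = trans (sym (+-distrib-/ (⁺ prefixSum g j) (⁺ f fzero) 1)) (cong (λ x → (⁺ x) / 1) (prefixSum-rotate j j<n))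

    tRows-rotate-predMod : sumFin f ≡ m → ∀ {k} → 1 ≤ k → k ≤ suc n →
                           tRows m g (predMod (suc n) k) ≡ tRows m f k ℚ.+ shiftConstant
    tRows-rotate-predMod Σf≡m {suc zero} _ _ = begin
        tRows m g (suc n) ≡⟨ tRows-full m g (trans sumFin-rotate Σf≡m) ⟩
        0ℚ                ≡⟨ tRows-zero m g ⟨
        tRows m g 0       ≡⟨ tRows-rotate 0 (s≤s z≤n) ⟩
        tRows m f 1 ℚ.+ shiftConstant ∎
      where open ≡-Reasoning
    tRows-rotate-predMod _ {suc (suc j)} _ k≤n = tRows-rotate (suc j) k≤n

    IsArgmax-rotate : sumFin f ≡ m → ∀ {k} → 1 ≤ k → k ≤ suc n →
                      IsArgmax (suc n) (tRows m f) k ⇔ IsArgmax (suc n) (tRows m g) (predMod (suc n) k)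
    IsArgmax-rotate Σf≡m = IsArgmax-reindex (predMod (suc n)) (succMod (suc n)) shiftConstant
      (predMod-range (suc n)) (succMod-range (suc n)) (predMod-succMod (suc n)) (tRows-rotate-predMod Σf≡m)

mainTheorem16 : (m n r : ℕ) .{{_ : NonZero m}} .{{_ : NonZero n}} .{{_ : NonZero r}}
                (a : Tuple n r) → InZ m a → (k : ℕ) → 1 ≤ k → k ≤ n →
                (IsMax m a k → IsMax m (ρ· a) (predMod n k) × IsMax m (ρ⁻¹· a) (succMod n k))
                × (IsMax m a k ⇔ IsMax m (ρ· a) (predMod n k))
mainTheorem16 m (suc n) r a Σa≡m k 1≤k k≤n = (λ max → Equivalence.to ρ-max max , ρ⁻¹-max max) , ρ-max
  where
  b = ρ⁻¹· a
  a≗b∘shiftUp : rowSum a ≗ rowSum b ∘ shiftUp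
  a≗b∘shiftUp i = cong (sumFin ∘ a) (sym (shiftDown-shiftUp i))
  Σb≡m : sumFin (rowSum b) ≡ m
  Σb≡m = trans (sym (Rotation.sumFin-rotate (rowSum b) (rowSum a) a≗b∘shiftUp)) Σa≡m
  ρ-max : IsMax m a k ⇔ IsMax m (ρ· a) (predMod (suc n) k)
  ρ-max = Rotation.IsArgmax-rotate (rowSum a) (rowSum (ρ· a)) (λ _ → refl) m Σa≡m 1≤k k≤n
  ρ⁻¹-max : IsMax m a k → IsMax m b (succMod (suc n) k)
  ρ⁻¹-max max = let 1≤k+1 , k+1≤n = succMod-range (suc n) 1≤k k≤n in
    Equivalence.from (Rotation.IsArgmax-rotate (rowSum b) (rowSum a) a≗b∘shiftUp m Σb≡m 1≤k+1 k+1≤n)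
      (subst (IsMax m a) (sym (predMod-succMod (suc n) 1≤k k≤n)) max)
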